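{- Fix $k\ge2$ and write $A_xy=A_x(k,y)$. Suppose $m\equiv_k A_0b$, and let $m_{ -1}$ be the penultimate sandwiching value of $m$. (1) If $b>m_{ -1}$ then $m-1\equiv^s_k A_0(b-1)\cdot(k-1)+(k^{b-1}-1)$. (2) If $b=m_{ -1}>0$ then $m-1\equiv^s_k b\cdot p+q$ for some $p<k^{b-1}$ and some $q<b$.
   Context: Ackermann function: for $k\ge 2$, $a,b\ge 0$: $A_a(k,-1):=1$, $A_0(k,b):=k^b$, $A_{a+1}(k,b):=A_a(k,\cdot)^k(A_{a+1}(k,b-1))$, with $f^j$ the $j$-fold iterate. $k$-normal form and sandwiching: for $m>0$, $m\equiv_k A_ab+c$ means $m=A_ab+c$ and there exist $n\ge1$ and naturals $a_1..a_n$, $b_1..b_n$, $m_0..m_n$ (sandwiching values) with $m_0=0$; for $0\le i<n$: $A_{a_{i+1}}m_i\le m<A_{a_{i+1}+1}m_i$, $A_{a_{i+1}}b_{i+1}\le m<A_{a_{i+1}}(b_{i+1}+1)$, $m_{i+1}=A_{a_{i+1}}b_{i+1}$; $A_0m_n>m$; $a=a_n$, $b=b_n$. These data are unique. The penultimate sandwiching value is $m_{ -1}:=m_{n-1}$. $m\equiv_k A_ab$ means $m\equiv_k A_ab+0$. Extended $k$-normal form: $m\equiv^e_k A_ab\cdot p+q$ means $m\equiv_k A_ab+c$ for some $c$, $m=A_ab\cdot p+q$, and $0\le q<A_ab$. Simplified $k$-normal form: $m\equiv^s_k d\cdot p+q$ means there are $a,b$ with $d=A_ab$ and $m\equiv^e_k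 A_ab\cdot p+q$. -}

module Defs where

open import Data.Nat using (ℕ; zero; suc; _+_; _*_; _∸_; _^_; _≤_; _<_)
open import Data.Product using (Σ; ∃; _×_)
open import Relation.Binary.PropositionalEquality using (_≡_)

iter : (ℕ → ℕ) → ℕ → ℕ → ℕ
iter f zero    x = x
iter f (suc j) x = f (iter f j x)

-- step f k : the shifted function n ↦ A_{a+1}(k, n-1), where f = A_a(k,·)
step : (ℕ → ℕ) → ℕ → ℕ → ℕ
step f k zero    = 1
step f k (suc n) = iter f k (step f k n)

-- Ack' a k n = A_a(k, n - 1)  (shifted so that argument -1 becomes 0)
Ack' : ℕ → ℕ → ℕ → ℕ
Ack' zero    k zero    = 1
Ack' zero    k (suc b) = k ^ b
Ack' (suc a) k         = step (λ x → Ack' a k (suc x)) k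

A : ℕ → ℕ → ℕ → ℕ
A a k b = Ack' a k (suc b)

-- Sandwiching data (n, a_1..a_n, b_1..b_n, m_0..m_n) for m, sequences given
-- as functions ℕ → ℕ (a_i = as i, b_i = bs i, m_i = ms i; as 0, bs 0 unused)
record Sandwich (k m n : ℕ) (as bs ms : ℕ → ℕ) : Set where
  field
    n≥1   : 1 ≤ n
    m₀    : ms 0 ≡ 0
    lowA  : ∀ i → i < n → A (as (suc i)) k (ms i) ≤ m
    highA : ∀ i → i < n → m < A (suc (as (suc i))) k (ms i)
    lowB  : ∀ i → i < n → A (as (suc i)) k (bs (suc i)) ≤ m
    highB : ∀ i → i < n → m < A (as (suc i)) k (suc (bs (suc i)))
    next  : ∀ i → i < n → ms (suc i) ≡ A (as (suc i)) k (bs (suc i))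
    last  : m < A 0 k (ms n)

NFData : (k m n : ℕ) (as bs ms : ℕ → ℕ) (a b c : ℕ) → Set
NFData k m n as bs ms a b c =
  0 < m × m ≡ A a k b + c × Sandwich k m n as bs ms × a ≡ as n × b ≡ bs n

NF : (k m a b c : ℕ) → Set
NF k m a b c = Σ ℕ λ n → Σ (ℕ → ℕ) λ as → Σ (ℕ → ℕ) λ bs → Σ (ℕ → ℕ) λ ms →
  NFData k m n as bs ms a b c

ENF : (k m a b p q : ℕ) → Set
ENF k m a b p q = (∃ λ c → NF k m a b c) × m ≡ A a k b * p + q × q < A a k b

SNF : (k m d p q : ℕ) → Set
SNF k m d p q = Σ ℕ λ a → Σ ℕ λ b → d ≡ A a k b × ENF k m a b p q

module Submission where

-- Lowering m = k^b by one only affects the last step of its sandwiching chain.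
-- If m₋₁ < b, the chain still sandwiches k^b − 1 up to m₋₁, and its last step
-- becomes A₀(b−1) = k^(b−1), whence k^b − 1 = k^(b−1)·(k−1) + (k^(b−1) − 1).
-- If b = m₋₁ the last step disappears: the shortened chain ends at b and
-- k^b − 1 < A₀ b, so k^b − 1 = b·p + q is plain division by b.  The bound
-- p < k^(b−1) needs k ≤ b, which holds because b = A_a b′ with k^b < A_a (b′+1)
-- forces a ≥ 1.

open import Defs
open import Data.Nat using (ℕ; zero; suc; _+_; _*_; _∸_; _^_; _≤_; _<_; _≤′_; ≤′-refl; ≤′-step; z≤n; s≤s; s≤s⁻¹; z<s; pred; NonZero; >-nonZero; _/_; _%_)
open import Data.Nat.Properties
open import Data.Nat.DivMod using (m≡m%n+[m/n]*n; m%n<n; m<n*o⇒m/o<n)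
open import Data.Product using (Σ; _×_; _,_)
open import Data.Sum using (inj₁; inj₂)
open import Relation.Nullary using (yes; no; contradiction)
open import Relation.Binary.PropositionalEquality using (_≡_; _≢_; refl; sym; trans; cong; cong₂; subst)

_[_≔_] : (ℕ → ℕ) → ℕ → ℕ → ℕ → ℕ
(f [ n ≔ v ]) i with i ≟ n
... | yes _ = v
... | no  _ = f i

[≔]-≡ : ∀ f n v → (f [ n ≔ v ]) n ≡ v
[≔]-≡ f n v with n ≟ n
... | yes _   = refl
... | no  n≢n = contradiction refl n≢n

[≔]-≢ : ∀ f {n} v {i} → i ≢ n → (f [ n ≔ v ]) i ≡ f i
[≔]-≢ f {n} v {i} i≢n with i ≟ n
... | yes i≡n = contradiction i≡n i≢n
... | no  _   = refl

stepwise-mono-≤ : ∀ (f : ℕ → ℕ) {i j} → (∀ l → l < j → f l ≤ f (suc l)) → i ≤ j → f i ≤ f j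
stepwise-mono-≤ f steps i≤j = go (≤⇒≤′ i≤j) steps
  where
  go : ∀ {i j} → i ≤′ j → (∀ l → l < j → f l ≤ f (suc l)) → f i ≤ f j
  go ≤′-refl            _     = ≤-refl
  go (≤′-step {j} i≤′j) steps =
    ≤-trans (go i≤′j (λ l l<j → steps l (m<n⇒m<1+n l<j))) (steps j (n<1+n j))

pred[m*n]≡n*pred[m]+pred[n] : ∀ m n → .{{NonZero m}} → .{{NonZero n}} →
                              pred (m * n) ≡ n * pred m + pred n
pred[m*n]≡n*pred[m]+pred[n] (suc m) (suc n) =
  trans (+-comm n (m * suc n)) (cong (_+ n) (*-comm m (suc n)))

m≡n*[m/n]+m%n : ∀ m n .{{_ : NonZero n}} → m ≡ n * (m / n) + m % n
m≡n*[m/n]+m%n m n =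
  trans (m≡m%n+[m/n]*n m n) (trans (+-comm (m % n) _) (cong (_+ m % n) (*-comm (m / n) n)))

module Iteration {f : ℕ → ℕ} (f-inflationary : ∀ y → y < f y) where

  iter-≥ : ∀ j y → j + y ≤ iter f j y
  iter-≥ zero    y = ≤-refl
  iter-≥ (suc j) y = ≤-trans (s≤s (iter-≥ j y)) (f-inflationary (iter f j y))

  module _ {k : ℕ} (0<k : 0 < k) where

    step-< : ∀ n → step f k n < step f k (suc n)
    step-< n = ≤-trans (+-monoˡ-≤ (step f k n) 0<k) (iter-≥ k (step f k n))

    step-inflationary : ∀ n → n < step f k n
    step-inflationary zero    = z<s
    step-inflationary (suc n) = ≤-<-trans (step-inflationary n) (step-< n)

    step-mono-≤ : ∀ {x y} → x ≤ y → step f k x ≤ step f k y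
    step-mono-≤ = stepwise-mono-≤ (step f k) (λ l _ → <⇒≤ (step-< l))

    k<iter-step : ∀ n → k < iter f k (step f k n)
    k<iter-step n = ≤-trans (m<m+n k (≤-trans z<s (step-inflationary n))) (iter-≥ k (step f k n))

module _ {k : ℕ} (1<k : 1 < k) where

  private
    0<k : 0 < k
    0<k = <-trans z<s 1<k

    instance
      k-nonZero : NonZero k
      k-nonZero = >-nonZero 0<k

  n<k^n : ∀ n → n < k ^ n
  n<k^n zero    = z<s
  n<k^n (suc n) = ≤-<-trans (n<k^n n) (^-monoʳ-< k 1<k (n<1+n n))

  pred[k^n]<k^n : ∀ n → pred (k ^ n) < k ^ n
  pred[k^n]<k^n n = ∸-monoʳ-< z<s (m^n>0 k n)

  A-inflationary : ∀ a x → x < A a k x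
  A-inflationary zero    x = n<k^n x
  A-inflationary (suc a) x =
    <⇒≤ (Iteration.step-inflationary (A-inflationary a) 0<k (suc x))

  A-mono-≤ : ∀ a {x y} → x ≤ y → A a k x ≤ A a k y
  A-mono-≤ zero    x≤y = ^-monoʳ-≤ k x≤y
  A-mono-≤ (suc a) x≤y = Iteration.step-mono-≤ (A-inflationary a) 0<k (s≤s x≤y)

  k<A-suc : ∀ a x → k < A (suc a) k x
  k<A-suc a = Iteration.k<iter-step (A-inflationary a) 0<k

  k^A[x]<A[1+x]⇒k<A[x] : ∀ a x → k ^ A a k x < A a k (suc x) → k < A a k x
  k^A[x]<A[1+x]⇒k<A[x] zero    x k^A<A = contradiction k^A<A (≤⇒≯ (^-monoʳ-≤ k (n<k^n x)))
  k^A[x]<A[1+x]⇒k<A[x] (suc a) x _     = k<A-suc a x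

  module SandwichProperties {m n as bs ms} (S : Sandwich k m n as bs ms) where
    open Sandwich S

    ms≤bs : ∀ i → i < n → ms i ≤ bs (suc i)
    ms≤bs i i<n = ≮⇒≥ λ bs<ms →
      <⇒≱ (highB i i<n) (≤-trans (A-mono-≤ (as (suc i)) bs<ms) (lowA i i<n))

    A-ms≤ms-suc : ∀ i → i < n → A (as (suc i)) k (ms i) ≤ ms (suc i)
    A-ms≤ms-suc i i<n =
      ≤-trans (A-mono-≤ (as (suc i)) (ms≤bs i i<n)) (≤-reflexive (sym (next i i<n)))

    ms-mono-≤ : ∀ {i j} → i ≤ j → j ≤ n → ms i ≤ ms j
    ms-mono-≤ {j = j} i≤j j≤n = stepwise-mono-≤ ms ms-step i≤j
      where
      ms-step : ∀ l → l < j → ms l ≤ ms (suc l)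
      ms-step l l<j = ≤-trans (<⇒≤ (A-inflationary (as (suc l)) (ms l)))
                              (A-ms≤ms-suc l (<-≤-trans l<j j≤n))

    0<m : 0 < m
    0<m = <-≤-trans (≤-<-trans z≤n (A-inflationary (as 1) (ms 0))) (lowA 0 n≥1)

  A-last≤m : ∀ {m n as bs ms} → Sandwich k m n as bs ms → A (as n) k (bs n) ≤ m
  A-last≤m {n = zero}  S = contradiction (Sandwich.n≥1 S) λ ()
  A-last≤m {n = suc n} S = Sandwich.lowB S n (n<1+n n)

  sandwich⇒SNF : ∀ {m n as bs ms d p q} → Sandwich k m n as bs ms →
                 d ≡ A (as n) k (bs n) → m ≡ d * p + q → q < d → SNF k m d p q
  sandwich⇒SNF {m} {n} {as} {bs} {ms} S refl m≡dp+q q<d =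
    as n , bs n , refl ,
    ((m ∸ A (as n) k (bs n) , n , as , bs , ms ,
      SandwichProperties.0<m S , sym (m+[n∸m]≡n (A-last≤m S)) , S , refl , refl) ,
     m≡dp+q , q<d)

  sandwich-prefix : ∀ {m m′ n j as bs ms} → Sandwich k m n as bs ms → 1 ≤ j → j ≤ n →
                    ms j ≤ m′ → m′ ≤ m → m′ < A 0 k (ms j) → Sandwich k m′ j as bs ms
  sandwich-prefix {m′ = m′} {n} {j} {as} {bs} {ms} S 1≤j j≤n msj≤m′ m′≤m m′<A = record
    { n≥1   = 1≤j
    ; m₀    = m₀
    ; lowA  = λ i i<j → ≤-trans (A-ms≤ms-suc i (in-range i<j)) (ms≤m′ i<j)
    ; highA = λ i i<j → ≤-<-trans m′≤m (highA i (in-range i<j))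
    ; lowB  = λ i i<j → ≤-trans (≤-reflexive (sym (next i (in-range i<j)))) (ms≤m′ i<j)
    ; highB = λ i i<j → ≤-<-trans m′≤m (highB i (in-range i<j))
    ; next  = λ i i<j → next i (in-range i<j)
    ; last  = m′<A
    }
    where
    open Sandwich S
    open SandwichProperties S

    in-range : ∀ {i} → i < j → i < n
    in-range i<j = <-≤-trans i<j j≤n

    ms≤m′ : ∀ {i} → i < j → ms (suc i) ≤ m′
    ms≤m′ i<j = ≤-trans (ms-mono-≤ i<j j≤n) msj≤m′

  sandwich-last-step :
    ∀ {m m′ n as bs ms b′} → Sandwich k m (suc n) as bs ms → m′ ≤ m →
    A (as (suc n)) k (ms n) ≤ m′ → A (as (suc n)) k b′ ≤ m′ →
    m′ < A (as (suc n)) k (suc b′) → m′ < A 0 k (A (as (suc n)) k b′) →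
    Sandwich k m′ (suc n) as (bs [ suc n ≔ b′ ]) (ms [ suc n ≔ A (as (suc n)) k b′ ])
  sandwich-last-step {m′ = m′} {n} {as} {bs} {ms} {b′} S m′≤m A-msn≤m′ A-b′≤m′ m′<A-suc-b′ m′<A0 =
    record
    { n≥1   = s≤s z≤n
    ; m₀    = trans (ms′-≤n z≤n) m₀
    ; lowA  = lowA′
    ; highA = highA′
    ; lowB  = lowB′
    ; highB = highB′
    ; next  = next′
    ; last  = subst (λ v → m′ < A 0 k v) (sym ([≔]-≡ ms (suc n) a-b′)) m′<A0
    }
    where
    open Sandwich S
    open SandwichProperties S

    a-b′ : ℕ
    a-b′ = A (as (suc n)) k b′

    ms′-≤n : ∀ {i} → i ≤ n → (ms [ suc n ≔ a-b′ ]) i ≡ ms i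
    ms′-≤n i≤n = [≔]-≢ ms a-b′ (<⇒≢ (s≤s i≤n))

    bs′-<n : ∀ {i} → i < n → (bs [ suc n ≔ b′ ]) (suc i) ≡ bs (suc i)
    bs′-<n i<n = [≔]-≢ bs b′ (<⇒≢ (s≤s i<n))

    ms≤m′ : ∀ {i} → i ≤ n → ms i ≤ m′
    ms≤m′ i≤n = ≤-trans (ms-mono-≤ i≤n (n≤1+n n))
                        (≤-trans (<⇒≤ (A-inflationary (as (suc n)) (ms n))) A-msn≤m′)

    lowA′ : ∀ i → i < suc n → A (as (suc i)) k ((ms [ suc n ≔ a-b′ ]) i) ≤ m′
    lowA′ i i<1+n rewrite ms′-≤n (s≤s⁻¹ i<1+n) with m<1+n⇒m<n∨m≡n i<1+n
    ... | inj₁ i<n  = ≤-trans (A-ms≤ms-suc i (m<n⇒m<1+n i<n)) (ms≤m′ i<n)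
    ... | inj₂ refl = A-msn≤m′

    highA′ : ∀ i → i < suc n → m′ < A (suc (as (suc i))) k ((ms [ suc n ≔ a-b′ ]) i)
    highA′ i i<1+n rewrite ms′-≤n (s≤s⁻¹ i<1+n) = ≤-<-trans m′≤m (highA i i<1+n)

    lowB′ : ∀ i → i < suc n → A (as (suc i)) k ((bs [ suc n ≔ b′ ]) (suc i)) ≤ m′
    lowB′ i i<1+n with m<1+n⇒m<n∨m≡n i<1+n
    ... | inj₁ i<n  rewrite bs′-<n i<n =
      ≤-trans (≤-reflexive (sym (next i i<1+n))) (ms≤m′ i<n)
    ... | inj₂ refl rewrite [≔]-≡ bs (suc n) b′ = A-b′≤m′

    highB′ : ∀ i → i < suc n → m′ < A (as (suc i)) k (suc ((bs [ suc n ≔ b′ ]) (suc i)))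
    highB′ i i<1+n with m<1+n⇒m<n∨m≡n i<1+n
    ... | inj₁ i<n  rewrite bs′-<n i<n = ≤-<-trans m′≤m (highB i i<1+n)
    ... | inj₂ refl rewrite [≔]-≡ bs (suc n) b′ = m′<A-suc-b′

    next′ : ∀ i → i < suc n →
            (ms [ suc n ≔ a-b′ ]) (suc i) ≡ A (as (suc i)) k ((bs [ suc n ≔ b′ ]) (suc i))
    next′ i i<1+n with m<1+n⇒m<n∨m≡n i<1+n
    ... | inj₁ i<n  rewrite bs′-<n i<n | ms′-≤n i<n = next i i<1+n
    ... | inj₂ refl rewrite [≔]-≡ bs (suc n) b′ | [≔]-≡ ms (suc n) a-b′ = refl

  pred-^-SNF-base : ∀ {m n as bs ms b} → Sandwich k m (suc n) as bs ms → as (suc n) ≡ 0 →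
                    m ≡ k ^ suc b → ms n < suc b →
                    SNF k (m ∸ 1) (A 0 k b) (k ∸ 1) (k ^ b ∸ 1)
  pred-^-SNF-base {n = n} {as} {bs} {ms} {b} S a≡0 refl ms<1+b =
    sandwich⇒SNF S′ (cong₂ (λ a c → A a k c) (sym a≡0) (sym ([≔]-≡ bs (suc n) b)))
                    (pred[m*n]≡n*pred[m]+pred[n] k (k ^ b) {{k-nonZero}} {{m^n≢0 k b}})
                    (pred[k^n]<k^n b)
    where
    k^b≤pred : k ^ b ≤ pred (k ^ suc b)
    k^b≤pred = <⇒≤pred (^-monoʳ-< k 1<k (n<1+n b))

    A-msn≤pred : A (as (suc n)) k (ms n) ≤ pred (k ^ suc b)
    A-msn≤pred rewrite a≡0 = ≤-trans (^-monoʳ-≤ k (s≤s⁻¹ ms<1+b)) k^b≤pred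

    A-b≤pred : A (as (suc n)) k b ≤ pred (k ^ suc b)
    A-b≤pred rewrite a≡0 = k^b≤pred

    pred<A-suc-b : pred (k ^ suc b) < A (as (suc n)) k (suc b)
    pred<A-suc-b rewrite a≡0 = pred[k^n]<k^n (suc b)

    pred<A0-A-b : pred (k ^ suc b) < A 0 k (A (as (suc n)) k b)
    pred<A0-A-b rewrite a≡0 = <-≤-trans (pred[k^n]<k^n (suc b)) (^-monoʳ-≤ k (n<k^n b))

    S′ : Sandwich k (pred (k ^ suc b)) (suc n) as (bs [ suc n ≔ b ])
                  (ms [ suc n ≔ A (as (suc n)) k b ])
    S′ = sandwich-last-step S (m∸n≤m _ 1) A-msn≤pred A-b≤pred pred<A-suc-b pred<A0-A-b

  pred-^-SNF-exponent : ∀ {m n as bs ms b} → Sandwich k m (suc n) as bs ms →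
                        m ≡ k ^ suc b → suc b ≡ ms n →
                        Σ ℕ λ p → Σ ℕ λ q → p < k ^ b × q < suc b × SNF k (m ∸ 1) (suc b) p q
  pred-^-SNF-exponent {n = zero} S _ 1+b≡ms₀ = contradiction (trans 1+b≡ms₀ (Sandwich.m₀ S)) 1+n≢0
  pred-^-SNF-exponent {n = suc n} {as} {bs} {ms} {b} S refl 1+b≡ms =
    x / suc b , x % suc b , x/[1+b]<k^b , m%n<n x (suc b) ,
    sandwich⇒SNF S′ 1+b≡A (m≡n*[m/n]+m%n x (suc b)) (m%n<n x (suc b))
    where
    open Sandwich S
    open ≤-Reasoning

    x : ℕ
    x = pred (k ^ suc b)

    1+b≡A : suc b ≡ A (as (suc n)) k (bs (suc n))
    1+b≡A = trans 1+b≡ms (next n (m<n⇒m<1+n (n<1+n n)))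

    k<1+b : k < suc b
    k<1+b = subst (k <_) (sym 1+b≡A) (k^A[x]<A[1+x]⇒k<A[x] (as (suc n)) (bs (suc n))
      (subst (λ d → k ^ d < A (as (suc n)) k (suc (bs (suc n)))) 1+b≡A
             (highB n (m<n⇒m<1+n (n<1+n n)))))

    x/[1+b]<k^b : x / suc b < k ^ b
    x/[1+b]<k^b = m<n*o⇒m/o<n (begin-strict
      x             <⟨ pred[k^n]<k^n (suc b) ⟩
      k * k ^ b     ≤⟨ *-monoˡ-≤ (k ^ b) (<⇒≤ k<1+b) ⟩
      suc b * k ^ b ≡⟨ *-comm (suc b) (k ^ b) ⟩
      k ^ b * suc b ∎)

    S′ : Sandwich k x (suc n) as bs ms
    S′ = sandwich-prefix S (s≤s z≤n) (n≤1+n (suc n))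
                         (subst (_≤ x) 1+b≡ms (<⇒≤pred (n<k^n (suc b)))) (m∸n≤m _ 1)
                         (subst (λ v → x < k ^ v) 1+b≡ms (pred[k^n]<k^n (suc b)))

lemma3p11 : (k : ℕ) → 2 ≤ k → (m b n : ℕ) → (as bs ms : ℕ → ℕ) →
    NFData k m n as bs ms 0 b 0 →
    (ms (n ∸ 1) < b →
      SNF k (m ∸ 1) (A 0 k (b ∸ 1)) (k ∸ 1) (k ^ (b ∸ 1) ∸ 1))
    × (b ≡ ms (n ∸ 1) → 0 < b →
      Σ ℕ λ p → Σ ℕ λ q → p < k ^ (b ∸ 1) × q < b × SNF k (m ∸ 1) b p q)
lemma3p11 k 1<k m zero    n       as bs ms _ = (λ ()) , (λ _ ())
lemma3p11 k 1<k m (suc b) zero    as bs ms (_ , _ , S , _ , _) = contradiction (Sandwich.n≥1 S) λ ()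
lemma3p11 k 1<k m (suc b) (suc n) as bs ms (_ , m≡k^b+0 , S , 0≡a , _) =
  pred-^-SNF-base 1<k S (sym 0≡a) m≡k^b ,
  λ 1+b≡ms _ → pred-^-SNF-exponent 1<k S m≡k^b 1+b≡ms
  where
  m≡k^b : m ≡ k ^ suc b
  m≡k^b = trans m≡k^b+0 (+-identityʳ _)
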